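{- Let $P$ be an extended logic program and let $P_1,P_2$ be extended logic programs that are tau-comp (with respect to the set $\mathcal{A}$ of atoms occurring in $P\cup P_1\cup P_2$). If $P_1\equiv_{N_2}P_2$, then the update answer sets of $(P,P_1)$ and of $(P,P_2)$ coincide, i.e. $P\oplus_1P_1\equiv P\oplus_1P_2$.
   Context: Formulas use $\wedge,\vee,\rightarrow,\bot$ and strong negation $\sim$; $\lnot F$ is $F\rightarrow\bot$. A literal is an atom $a$ or $\sim a$; $\sim L$ is the complement of $L$. $Lit_{\mathcal{A}}$ is the set of literals over $\mathcal{A}$. An extended logic program (ELP) is a finite set of rules $r$: $L\leftarrow B_1,\dots,B_m,\lnot B_{m+1},\dots,\lnot B_n$ with $L,B_i$ literals, $\top$ or $\bot$; $H(r)=L$, $B(r)$ the body; constraint if $H(r)=\bot$. $P$ is tau-comp w.r.t. $\mathcal{A}$ if every rule $l\leftarrow l$, $l\in Lit_{\mathcal{A}}$, belongs to $P$. $\mathrm{N}_2$ is intuitionistic logic plus Nelson's axioms ($\sim(\alpha\rightarrow\beta)\leftrightarrow\alpha\wedge\sim\beta$, $\sim(\alpha\wedge\beta)\leftrightarrow\sim\alpha\vee\sim\beta$, $\sim(\alpha\vee\beta)\leftrightarrow\sim\alpha\wedge\sim\beta$, $\alpha\leftrightarrow\sim\sim\alpha$, $\sim\lnot\alpha\leftrightarrow\alpha$, $\sim a\rightarrow\lnot a$) and $\alpha\vee(\alpha\rightarrow\beta)\vee\lnot\beta$; $T\equiv_{N_2}T'$ means mutual derivability. For a finite set of formulas $T$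 over atoms $\mathcal{B}$, a consistent $M\subseteq Lit_{\mathcal{B}}$ is an answer set iff $T\cup\{\lnot l: l\in Lit_{\mathcal{B}}\setminus M\}\cup\{\lnot\lnot l:l\in M\}$ is $\mathrm{N}_2$-consistent and $\mathrm{N}_2$-derives each element of $M$. Operator $\oplus_1$ for ELPs $Q_1,Q_2$ over atoms $\mathcal{A}$: add fresh atoms $rej(r)$ for each rule $r$ (distinct names for rules of $Q_1$ and $Q_2$) and $A_1,A_2$ for each $A\in\mathcal{A}$; $L_i$ replaces the atom $A$ of $L$ by $A_i$. $Q_1\oplus_1Q_2$ consists of: (i) all constraints of $Q_1\cup Q_2$; (ii) for each non-constraint $r\in Q_1$ with $H(r)=L$: $L_1\leftarrow B(r),\lnot rej(r)$ and $rej(r)\leftarrow B(r),\sim L_2$; (iii) for each non-constraint $r\in Q_2$ with $H(r)=L$: $L_2\leftarrow B(r)$; (iv) for each literal $L$ occurring in $Q_1\cup Q_2$: $L_1\leftarrow L_2$ and $L\leftarrow L_1$. The update answer sets of $(Q_1,Q_2)$ are the sets $S'\cap Lit_{\mathcal{A}}$ with $S'$ an answer set of $Q_1\oplus_1Q_2$. -}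

module Defs where

open import Data.Nat using (ℕ)
open import Data.List using (List; []; _∷_; _++_; map; concat; length; upTo; zip)
open import Data.List.Membership.Propositional using (_∈_)
open import Data.Product using (Σ; _×_; _,_)
open import Data.Sum using (_⊎_)
open import Relation.Nullary using (¬_)
open import Relation.Binary.PropositionalEquality using (_≡_)

-- Formulas over an atom type X: ∧, ∨, →, ⊥ and strong negation ∼

infixr 6 _∧_
infixr 5 _∨_
infixr 4 _⇒_

data Form (X : Set) : Set where
  var  : X → Form X
  falsum : Form X
  _∧_  : Form X → Form X → Form X
  _∨_  : Form X → Form X → Form X
  _⇒_  : Form X → Form X → Form X
  ∼_   : Form X → Form X

module _ {X : Set} where
  neg : Form X → Form X
  neg F = F ⇒ falsum

  verum : Form X
  verum = falsum ⇒ falsum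

  _⇔F_ : Form X → Form X → Form X
  A ⇔F B = (A ⇒ B) ∧ (B ⇒ A)

data N2Axiom {X : Set} : Form X → Set where
  K    : ∀ {a b} → N2Axiom (a ⇒ b ⇒ a)
  S    : ∀ {a b c} → N2Axiom ((a ⇒ b ⇒ c) ⇒ (a ⇒ b) ⇒ a ⇒ c)
  ∧E₁  : ∀ {a b} → N2Axiom (a ∧ b ⇒ a)
  ∧E₂  : ∀ {a b} → N2Axiom (a ∧ b ⇒ b)
  ∧I   : ∀ {a b} → N2Axiom (a ⇒ b ⇒ a ∧ b)
  ∨I₁  : ∀ {a b} → N2Axiom (a ⇒ a ∨ b)
  ∨I₂  : ∀ {a b} → N2Axiom (b ⇒ a ∨ b)
  ∨E   : ∀ {a b c} → N2Axiom ((a ⇒ c) ⇒ (b ⇒ c) ⇒ (a ∨ b ⇒ c))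
  ⊥E   : ∀ {a} → N2Axiom (falsum ⇒ a)
  N∼⇒  : ∀ {a b} → N2Axiom ((∼ (a ⇒ b)) ⇔F (a ∧ ∼ b))
  N∼∧  : ∀ {a b} → N2Axiom ((∼ (a ∧ b)) ⇔F (∼ a ∨ ∼ b))
  N∼∨  : ∀ {a b} → N2Axiom ((∼ (a ∨ b)) ⇔F (∼ a ∧ ∼ b))
  N∼∼  : ∀ {a} → N2Axiom (a ⇔F (∼ (∼ a)))
  N∼¬  : ∀ {a} → N2Axiom ((∼ (neg a)) ⇔F a)
  N∼at : ∀ {x} → N2Axiom (∼ (var x) ⇒ neg (var x))
  WEM  : ∀ {a b} → N2Axiom (a ∨ (a ⇒ b) ∨ neg b)

infix 2 _⊢_
data _⊢_ {X : Set} (Γ : Form X → Set) : Form X → Set where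
  hyp : ∀ {φ} → Γ φ → Γ ⊢ φ
  ax  : ∀ {φ} → N2Axiom φ → Γ ⊢ φ
  mp  : ∀ {φ ψ} → Γ ⊢ φ ⇒ ψ → Γ ⊢ φ → Γ ⊢ ψ

N2Consistent : {X : Set} → (Form X → Set) → Set
N2Consistent Γ = ¬ (Γ ⊢ falsum)

_≡N2_ : {X : Set} → (Form X → Set) → (Form X → Set) → Set
T ≡N2 T' = (∀ φ → T' φ → T ⊢ φ) × (∀ φ → T φ → T' ⊢ φ)

data Lit (X : Set) : Set where
  pos : X → Lit X
  sneg : X → Lit X

module _ {X : Set} where
  compl : Lit X → Lit X
  compl (pos a) = sneg a
  compl (sneg a) = pos a

  atomOf : Lit X → X
  atomOf (pos a) = a
  atomOf (sneg a) = a

  litF : Lit X → Form X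
  litF (pos a) = var a
  litF (sneg a) = ∼ (var a)

LitOver : {X : Set} → List X → Lit X → Set
LitOver B l = atomOf l ∈ B

data BElem (X : Set) : Set where
  blit : Lit X → BElem X
  btop : BElem X
  bbot : BElem X

data Head (X : Set) : Set where
  hlit : Lit X → Head X
  hbot : Head X

record Rule (X : Set) : Set where
  constructor rule
  field
    head  : Head X
    pbody : List (BElem X)
    nbody : List (BElem X)   -- Bₘ₊₁ … Bₙ  (under default negation ¬)
open Rule public

Program : Set → Set
Program X = List (Rule X)

module _ {X : Set} where
  belemF : BElem X → Form X
  belemF (blit l) = litF l
  belemF btop = verum
  belemF bbot = falsum

  headF : Head X → Form X
  headF (hlit l) = litF l
  headF hbot = falsum

  conj : List (Form X) → Form X
  conj [] = verum
  conj (φ ∷ φs) = φ ∧ conj φs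

  ruleF : Rule X → Form X
  ruleF r = conj (map belemF (pbody r) ++ map (λ b → neg (belemF b)) (nbody r)) ⇒ headF (head r)

  progT : Program X → Form X → Set
  progT P φ = φ ∈ map ruleF P

  belemLits : BElem X → List (Lit X)
  belemLits (blit l) = l ∷ []
  belemLits btop = []
  belemLits bbot = []

  headLits : Head X → List (Lit X)
  headLits (hlit l) = l ∷ []
  headLits hbot = []

  ruleLits : Rule X → List (Lit X)
  ruleLits r = headLits (head r) ++ concat (map belemLits (pbody r)) ++ concat (map belemLits (nbody r))

  progLits : Program X → List (Lit X)
  progLits P = concat (map ruleLits P)

  progAtoms : Program X → List X
  progAtoms P = map atomOf (progLits P)

  tauRule : Lit X → Rule X
  tauRule l = rule (hlit l) (blit l ∷ []) []

  TauComp : List X → Program X → Set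
  TauComp 𝒜 P = ∀ l → LitOver 𝒜 l → tauRule l ∈ P

module _ {X : Set} where
  Completed : (Form X → Set) → List X → (Lit X → Set) → Form X → Set
  Completed T B M φ =
    T φ
    ⊎ Σ (Lit X) (λ l → LitOver B l × ¬ M l × φ ≡ neg (litF l))
    ⊎ Σ (Lit X) (λ l → M l × φ ≡ neg (neg (litF l)))

  ConsistentLits : (Lit X → Set) → Set
  ConsistentLits M = ∀ a → ¬ (M (pos a) × M (sneg a))

  AnswerSet : (Form X → Set) → List X → (Lit X → Set) → Set
  AnswerSet T B M =
    (∀ l → M l → LitOver B l)
    × ConsistentLits M
    × N2Consistent (Completed T B M)
    × (∀ l → M l → Completed T B M ⊢ litF l)

-- atoms of Q₁ ⊕₁ Q₂ (base atoms are natural numbers)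
data XAtom : Set where
  orig : ℕ → XAtom
  sub₁ : ℕ → XAtom
  sub₂ : ℕ → XAtom
  rej₁ : ℕ → XAtom      -- rej(r) for the k-th rule r of Q₁
  rej₂ : ℕ → XAtom      -- rej(r) for the k-th rule r of Q₂

module _ {X Y : Set} (f : X → Y) where
  mapLit : Lit X → Lit Y
  mapLit (pos a) = pos (f a)
  mapLit (sneg a) = sneg (f a)

  mapBElem : BElem X → BElem Y
  mapBElem (blit l) = blit (mapLit l)
  mapBElem btop = btop
  mapBElem bbot = bbot

  mapHead : Head X → Head Y
  mapHead (hlit l) = hlit (mapLit l)
  mapHead hbot = hbot

  mapRule : Rule X → Rule Y
  mapRule r = rule (mapHead (head r)) (map mapBElem (pbody r)) (map mapBElem (nbody r))

indexed : {A : Set} → List A → List (ℕ × A)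
indexed xs = zip (upTo (length xs)) xs

constraintPart : Rule ℕ → List (Rule XAtom)
constraintPart r with head r
... | hbot = mapRule orig r ∷ []
... | hlit _ = []

part₁ : ℕ × Rule ℕ → List (Rule XAtom)
part₁ (k , r) with head r
... | hbot = []
... | hlit L =
  rule (hlit (mapLit sub₁ L))
       (map (mapBElem orig) (pbody r))
       (map (mapBElem orig) (nbody r) ++ blit (pos (rej₁ k)) ∷ [])
  ∷ rule (hlit (pos (rej₁ k)))
         (map (mapBElem orig) (pbody r) ++ blit (compl (mapLit sub₂ L)) ∷ [])
         (map (mapBElem orig) (nbody r))
  ∷ []

part₂ : Rule ℕ → List (Rule XAtom)
part₂ r with head r
... | hbot = []
... | hlit L = rule (hlit (mapLit sub₂ L)) (map (mapBElem orig) (pbody r)) (map (mapBElem orig) (nbody r)) ∷ []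

part₄ : Lit ℕ → List (Rule XAtom)
part₄ L =
  rule (hlit (mapLit sub₁ L)) (blit (mapLit sub₂ L) ∷ []) []
  ∷ rule (hlit (mapLit orig L)) (blit (mapLit sub₁ L) ∷ []) []
  ∷ []

_⊕₁_ : Program ℕ → Program ℕ → Program XAtom
Q₁ ⊕₁ Q₂ =
  concat (map constraintPart (Q₁ ++ Q₂))
  ++ concat (map part₁ (indexed Q₁))
  ++ concat (map part₂ Q₂)
  ++ concat (map part₄ (progLits (Q₁ ++ Q₂)))

extAtoms : List ℕ → Program ℕ → Program ℕ → List XAtom
extAtoms 𝒜 Q₁ Q₂ =
  map orig 𝒜 ++ map sub₁ 𝒜 ++ map sub₂ 𝒜
  ++ map rej₁ (upTo (length Q₁)) ++ map rej₂ (upTo (length Q₂))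

UpdateAnswerSet : List ℕ → Program ℕ → Program ℕ → (Lit ℕ → Set) → Set₁
UpdateAnswerSet 𝒜 Q₁ Q₂ U =
  Σ (Lit XAtom → Set) λ S' →
    AnswerSet (progT (Q₁ ⊕₁ Q₂)) (extAtoms 𝒜 Q₁ Q₂) S'
    × (∀ l → (U l → S' (mapLit orig l) × LitOver 𝒜 l)
           × (S' (mapLit orig l) × LitOver 𝒜 l → U l))

{-# OPTIONS --safe #-}
module Submission where

-- P ⊕₁ P₁ and P ⊕₁ P₂ are N₂-equivalent: the rules of P₂, renamed to the original atoms,
-- follow from P ⊕₁ P₁ because they follow from P₁, and the tautologies L ← L of P₁ then yield
-- the copies L₂ ← B of these rules.  Both programs have the same atoms except for the rej atoms
-- of the rules of the update, which occur in no rule: a here-and-there countermodel shows that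
-- no answer set contains them, and substituting ⊥ for them carries derivations from one
-- completion over to the other.  So the two programs have the same answer sets, hence the same
-- update answer sets.

open import Defs
open import Data.Bool.Base using (Bool; true; false; _≤_; b≤b; f≤t)
open import Data.Bool.Properties using (≤-refl; ≤-trans; ≤-maximum)
open import Data.Empty using (⊥; ⊥-elim)
open import Data.List.Base using (List; []; _∷_; _++_; map; concat; length; upTo; zip)
open import Data.List.Properties using (map-++; concat-++; map-id-local)
open import Data.List.Membership.Propositional using (_∈_)
open import Data.List.Membership.Propositional.Properties
  using (∈-map⁺; ∈-map⁻; ∈-++⁺ˡ; ∈-++⁺ʳ; ∈-++⁻; ∈-concat⁺′)
open import Data.List.Relation.Unary.All as All using (All; []; _∷_)
open import Data.List.Relation.Unary.All.Properties using (++⁺; ++⁻; concat⁺; concat⁻; map⁺; map⁻)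
open import Data.List.Relation.Unary.Any using (here; there)
open import Data.Nat.Base using (ℕ)
open import Data.Product.Base using (∃; _×_; _,_; proj₁; proj₂; swap)
open import Data.Sum.Base using (_⊎_; inj₁; inj₂)
open import Data.Unit.Base using (⊤; tt)
open import Function.Base using (_∘_; id)
open import Relation.Nullary.Decidable.Core using (yes; no; ¬¬-excluded-middle)
open import Relation.Nullary.Negation.Core using (¬_)
open import Relation.Binary.PropositionalEquality.Core
  using (_≡_; refl; sym; trans; cong; cong₂; subst)

module _ {X : Set} {Γ : Form X → Set} where
  ⇒-refl : ∀ {a} → Γ ⊢ a ⇒ a
  ⇒-refl {a} = mp (mp (ax (S {b = a ⇒ a})) (ax K)) (ax K)

  ⇒-trans : ∀ {a b c} → Γ ⊢ a ⇒ b → Γ ⊢ b ⇒ c → Γ ⊢ a ⇒ c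
  ⇒-trans ab bc = mp (mp (ax S) (mp (ax K) bc)) ab

  ∧-intro : ∀ {a b} → Γ ⊢ a → Γ ⊢ b → Γ ⊢ a ∧ b
  ∧-intro p q = mp (mp (ax ∧I) p) q

  ∧-verum-intro : ∀ {a} → Γ ⊢ a ⇒ a ∧ verum
  ∧-verum-intro = mp (mp (ax S) (ax ∧I)) (mp (ax K) ⇒-refl)

  ⇒-∧-verum : ∀ {a b} → Γ ⊢ a ∧ verum ⇒ b → Γ ⊢ a ⇒ b
  ⇒-∧-verum = ⇒-trans ∧-verum-intro

infix 2 _⊢*_
_⊢*_ : {X : Set} → (Form X → Set) → (Form X → Set) → Set
Γ ⊢* Δ = ∀ φ → Δ φ → Γ ⊢ φ

⊢-cut : ∀ {X} {Γ Δ : Form X → Set} {φ} → Δ ⊢* Γ → Γ ⊢ φ → Δ ⊢ φ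
⊢-cut Δ⊢Γ (hyp φ∈Γ) = Δ⊢Γ _ φ∈Γ
⊢-cut Δ⊢Γ (ax a) = ax a
⊢-cut Δ⊢Γ (mp p q) = mp (⊢-cut Δ⊢Γ p) (⊢-cut Δ⊢Γ q)

⊢*-progT : ∀ {X} {Γ : Form X → Set} {Π} → All (λ r → Γ ⊢ ruleF r) Π → Γ ⊢* progT Π
⊢*-progT Π-derivable _ φ∈ with r , r∈ , refl ← ∈-map⁻ ruleF φ∈ = All.lookup Π-derivable r∈

-- Substitution of formulas for literals: ∼ is pushed down to the atoms along Nelson's
-- axioms and ∼x is replaced by σ (sneg x); ∼⊥ becomes ⊤, to which it is N₂-equivalent.
module _ {X Y : Set} where
  infixl 9 _⟦_⟧ _⟦_⟧∼
  _⟦_⟧ _⟦_⟧∼ : Form X → (Lit X → Form Y) → Form Y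
  var x ⟦ σ ⟧ = σ (pos x)
  falsum ⟦ σ ⟧ = falsum
  (a ∧ b) ⟦ σ ⟧ = a ⟦ σ ⟧ ∧ b ⟦ σ ⟧
  (a ∨ b) ⟦ σ ⟧ = a ⟦ σ ⟧ ∨ b ⟦ σ ⟧
  (a ⇒ b) ⟦ σ ⟧ = a ⟦ σ ⟧ ⇒ b ⟦ σ ⟧
  (∼ a) ⟦ σ ⟧ = a ⟦ σ ⟧∼
  var x ⟦ σ ⟧∼ = σ (sneg x)
  falsum ⟦ σ ⟧∼ = verum
  (a ∧ b) ⟦ σ ⟧∼ = a ⟦ σ ⟧∼ ∨ b ⟦ σ ⟧∼
  (a ∨ b) ⟦ σ ⟧∼ = a ⟦ σ ⟧∼ ∧ b ⟦ σ ⟧∼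
  (a ⇒ b) ⟦ σ ⟧∼ = a ⟦ σ ⟧ ∧ b ⟦ σ ⟧∼
  (∼ a) ⟦ σ ⟧∼ = a ⟦ σ ⟧

  ⟦⟧-litF : ∀ (σ : Lit X → Form Y) l → litF l ⟦ σ ⟧ ≡ σ l
  ⟦⟧-litF σ (pos x) = refl
  ⟦⟧-litF σ (sneg x) = refl

  module _ {Γ : Form X → Set} {Δ : Form Y → Set} (σ : Lit X → Form Y)
           (σ-N∼at : ∀ x → Δ ⊢ σ (sneg x) ⇒ neg (σ (pos x)))
           (Γ-σ : ∀ φ → Γ φ → Δ ⊢ φ ⟦ σ ⟧) where
    ⊢-⟦⟧-axiom : ∀ {φ} → N2Axiom φ → Δ ⊢ φ ⟦ σ ⟧
    ⊢-⟦⟧-axiom K = ax K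
    ⊢-⟦⟧-axiom S = ax S
    ⊢-⟦⟧-axiom ∧E₁ = ax ∧E₁
    ⊢-⟦⟧-axiom ∧E₂ = ax ∧E₂
    ⊢-⟦⟧-axiom ∧I = ax ∧I
    ⊢-⟦⟧-axiom ∨I₁ = ax ∨I₁
    ⊢-⟦⟧-axiom ∨I₂ = ax ∨I₂
    ⊢-⟦⟧-axiom ∨E = ax ∨E
    ⊢-⟦⟧-axiom ⊥E = ax ⊥E
    ⊢-⟦⟧-axiom N∼⇒ = ∧-intro ⇒-refl ⇒-refl
    ⊢-⟦⟧-axiom N∼∧ = ∧-intro ⇒-refl ⇒-refl
    ⊢-⟦⟧-axiom N∼∨ = ∧-intro ⇒-refl ⇒-refl
    ⊢-⟦⟧-axiom N∼∼ = ∧-intro ⇒-refl ⇒-refl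
    ⊢-⟦⟧-axiom N∼¬ = ∧-intro (ax ∧E₁) ∧-verum-intro
    ⊢-⟦⟧-axiom (N∼at {x}) = σ-N∼at x
    ⊢-⟦⟧-axiom WEM = ax WEM

    ⊢-⟦⟧ : ∀ {φ} → Γ ⊢ φ → Δ ⊢ φ ⟦ σ ⟧
    ⊢-⟦⟧ (hyp φ∈Γ) = Γ-σ _ φ∈Γ
    ⊢-⟦⟧ (ax a) = ⊢-⟦⟧-axiom a
    ⊢-⟦⟧ (mp p q) = mp (⊢-⟦⟧ p) (⊢-⟦⟧ q)

module _ {X : Set} (Q : Lit X → Set) where
  BodySat : List (BElem X) → Set
  BodySat = All (All Q ∘ belemLits)

  RuleSat : Rule X → Set
  RuleSat r = All Q (headLits (head r)) × BodySat (pbody r) × BodySat (nbody r)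

  ruleSat-ruleLits : ∀ r → All Q (ruleLits r) → RuleSat r
  ruleSat-ruleLits r r-sat =
    let h-sat , b-sat = ++⁻ (headLits (head r)) r-sat
        pb-sat , nb-sat = ++⁻ (concat (map belemLits (pbody r))) b-sat
    in h-sat , map⁻ (concat⁻ pb-sat) , map⁻ (concat⁻ nb-sat)

  ruleSat-universal : (∀ l → Q l) → ∀ r → RuleSat r
  ruleSat-universal Q-all r =
    All.universal Q-all (headLits (head r)) , bodySat (pbody r) , bodySat (nbody r)
    where
    bodySat : ∀ bs → BodySat bs
    bodySat = All.universal (All.universal Q-all ∘ belemLits)

module _ {X : Set} where
  negsF : List (BElem X) → Form X
  negsF nb = conj (map (λ b → neg (belemF b)) nb)

  bodyF : List (BElem X) → List (BElem X) → Form X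
  bodyF pb nb = conj (map belemF pb ++ map (λ b → neg (belemF b)) nb)

bodySat-mapBElem : ∀ {X Y} {Q : Lit X → Set} {Q′ : Lit Y → Set} {ρ : X → Y} →
                   (∀ {l} → Q l → Q′ (mapLit ρ l)) →
                   ∀ {bs} → BodySat Q bs → BodySat Q′ (map (mapBElem ρ) bs)
bodySat-mapBElem {Q′ = Q′} {ρ} Q⇒Q′ = map⁺ ∘ All.map belemSat
  where
  belemSat : ∀ {b} → All _ (belemLits b) → All Q′ (belemLits (mapBElem ρ b))
  belemSat {blit l} (q ∷ []) = Q⇒Q′ q ∷ []
  belemSat {btop} [] = []
  belemSat {bbot} [] = []

module _ {X : Set} where
  mapLit-id : ∀ (l : Lit X) → mapLit id l ≡ l
  mapLit-id (pos x) = refl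
  mapLit-id (sneg x) = refl

  mapBElem-id : ∀ (b : BElem X) → mapBElem id b ≡ b
  mapBElem-id (blit l) = cong blit (mapLit-id l)
  mapBElem-id btop = refl
  mapBElem-id bbot = refl

  mapHead-id : ∀ (h : Head X) → mapHead id h ≡ h
  mapHead-id (hlit l) = cong hlit (mapLit-id l)
  mapHead-id hbot = refl

  mapRule-id : ∀ (r : Rule X) → mapRule id r ≡ r
  mapRule-id (rule h pb nb) =
    cong₂ (λ h′ (pb′ , nb′) → rule h′ pb′ nb′)
          (mapHead-id h) (cong₂ _,_ (mapBElems-id pb) (mapBElems-id nb))
    where
    mapBElems-id : ∀ bs → map (mapBElem id) bs ≡ bs
    mapBElems-id bs = map-id-local (All.universal mapBElem-id bs)

module _ {X Y : Set} (σ : Lit X → Form Y) (ρ : X → Y) {Q : Lit X → Set}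
         (σ-ρ : ∀ {l} → Q l → σ l ≡ litF (mapLit ρ l)) where
  ⟦⟧-belemF : ∀ {b} → All Q (belemLits b) → belemF b ⟦ σ ⟧ ≡ belemF (mapBElem ρ b)
  ⟦⟧-belemF {blit l} (q ∷ []) = trans (⟦⟧-litF σ l) (σ-ρ q)
  ⟦⟧-belemF {btop} [] = refl
  ⟦⟧-belemF {bbot} [] = refl

  ⟦⟧-negs : ∀ {nb} → BodySat Q nb → negsF nb ⟦ σ ⟧ ≡ negsF (map (mapBElem ρ) nb)
  ⟦⟧-negs [] = refl
  ⟦⟧-negs (q ∷ qs) = cong₂ (λ φ ψ → neg φ ∧ ψ) (⟦⟧-belemF q) (⟦⟧-negs qs)

  ⟦⟧-body : ∀ {pb nb} → BodySat Q pb → BodySat Q nb →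
            bodyF pb nb ⟦ σ ⟧ ≡ bodyF (map (mapBElem ρ) pb) (map (mapBElem ρ) nb)
  ⟦⟧-body [] nb-sat = ⟦⟧-negs nb-sat
  ⟦⟧-body (q ∷ qs) nb-sat = cong₂ _∧_ (⟦⟧-belemF q) (⟦⟧-body qs nb-sat)

  ⟦⟧-headF : ∀ {h} → All Q (headLits h) → headF h ⟦ σ ⟧ ≡ headF (mapHead ρ h)
  ⟦⟧-headF {hlit l} (q ∷ []) = trans (⟦⟧-litF σ l) (σ-ρ q)
  ⟦⟧-headF {hbot} [] = refl

  ⟦⟧-ruleF : ∀ {r} → RuleSat Q r → ruleF r ⟦ σ ⟧ ≡ ruleF (mapRule ρ r)
  ⟦⟧-ruleF (h-sat , pb-sat , nb-sat) = cong₂ _⇒_ (⟦⟧-body pb-sat nb-sat) (⟦⟧-headF h-sat)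

⟦⟧-ruleF-fixed : ∀ {X} (σ : Lit X → Form X) {Q : Lit X → Set} → (∀ {l} → Q l → σ l ≡ litF l) →
                 ∀ {r} → RuleSat Q r → ruleF r ⟦ σ ⟧ ≡ ruleF r
⟦⟧-ruleF-fixed σ σ-fixed {r} r-sat =
  trans (⟦⟧-ruleF σ id (λ {l} q → trans (σ-fixed q) (cong litF (sym (mapLit-id l)))) r-sat)
        (cong ruleF (mapRule-id r))

module _ {X Y : Set} (ρ : X → Y) where
  renameLit : Lit X → Form Y
  renameLit l = litF (mapLit ρ l)

  ⟦⟧-rename-ruleF : ∀ r → ruleF r ⟦ renameLit ⟧ ≡ ruleF (mapRule ρ r)
  ⟦⟧-rename-ruleF r = ⟦⟧-ruleF renameLit ρ (λ _ → refl) (ruleSat-universal (λ _ → ⊤) (λ _ → tt) r)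

  ⊢-rename : ∀ {Γ : Form X → Set} {Δ : Form Y → Set} → (∀ φ → Γ φ → Δ ⊢ φ ⟦ renameLit ⟧) →
             ∀ {φ} → Γ ⊢ φ → Δ ⊢ φ ⟦ renameLit ⟧
  ⊢-rename = ⊢-⟦⟧ renameLit (λ _ → ax N∼at)

-- Here-and-there models of N₂ with worlds false ("here") ≤ true ("there"); V w l says that w
-- verifies the literal l, and w ⊩⁻ φ that w verifies ∼ φ.
module HereThere {X : Set} (V : Bool → Lit X → Set)
                 (V-mono : ∀ {l} → V false l → V true l)
                 (V-consistent : ∀ w a → ¬ (V w (pos a) × V w (sneg a))) where
  infix 3 _⊩⁺_ _⊩⁻_
  _⊩⁺_ _⊩⁻_ : Bool → Form X → Set
  w ⊩⁺ var x = V w (pos x)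
  w ⊩⁺ falsum = ⊥
  w ⊩⁺ a ∧ b = (w ⊩⁺ a) × (w ⊩⁺ b)
  w ⊩⁺ a ∨ b = (w ⊩⁺ a) ⊎ (w ⊩⁺ b)
  w ⊩⁺ a ⇒ b = ∀ w′ → w ≤ w′ → w′ ⊩⁺ a → w′ ⊩⁺ b
  w ⊩⁺ ∼ a = w ⊩⁻ a
  w ⊩⁻ var x = V w (sneg x)
  w ⊩⁻ falsum = ⊤
  w ⊩⁻ a ∧ b = (w ⊩⁻ a) ⊎ (w ⊩⁻ b)
  w ⊩⁻ a ∨ b = (w ⊩⁻ a) × (w ⊩⁻ b)
  w ⊩⁻ a ⇒ b = (w ⊩⁺ a) × (w ⊩⁻ b)
  w ⊩⁻ ∼ a = w ⊩⁺ a

  ⊩-litF⁺ : ∀ {w} l → V w l → w ⊩⁺ litF l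
  ⊩-litF⁺ (pos x) v = v
  ⊩-litF⁺ (sneg x) v = v

  ⊩-litF⁻ : ∀ {w} l → w ⊩⁺ litF l → V w l
  ⊩-litF⁻ (pos x) v = v
  ⊩-litF⁻ (sneg x) v = v

  V-≤ : ∀ {w w′} → w ≤ w′ → ∀ {l} → V w l → V w′ l
  V-≤ f≤t = V-mono
  V-≤ b≤b = id

  ⊩⁺-≤ : ∀ {w w′} → w ≤ w′ → ∀ φ → w ⊩⁺ φ → w′ ⊩⁺ φ
  ⊩⁻-≤ : ∀ {w w′} → w ≤ w′ → ∀ φ → w ⊩⁻ φ → w′ ⊩⁻ φ
  ⊩⁺-≤ le (var x) = V-≤ le
  ⊩⁺-≤ le falsum ()
  ⊩⁺-≤ le (a ∧ b) (p , q) = ⊩⁺-≤ le a p , ⊩⁺-≤ le b q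
  ⊩⁺-≤ le (a ∨ b) (inj₁ p) = inj₁ (⊩⁺-≤ le a p)
  ⊩⁺-≤ le (a ∨ b) (inj₂ q) = inj₂ (⊩⁺-≤ le b q)
  ⊩⁺-≤ le (a ⇒ b) f w″ le′ = f w″ (≤-trans le le′)
  ⊩⁺-≤ le (∼ a) = ⊩⁻-≤ le a
  ⊩⁻-≤ le (var x) = V-≤ le
  ⊩⁻-≤ le falsum _ = tt
  ⊩⁻-≤ le (a ∧ b) (inj₁ p) = inj₁ (⊩⁻-≤ le a p)
  ⊩⁻-≤ le (a ∧ b) (inj₂ q) = inj₂ (⊩⁻-≤ le b q)
  ⊩⁻-≤ le (a ∨ b) (p , q) = ⊩⁻-≤ le a p , ⊩⁻-≤ le b q
  ⊩⁻-≤ le (a ⇒ b) (p , q) = ⊩⁺-≤ le a p , ⊩⁻-≤ le b q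
  ⊩⁻-≤ le (∼ a) = ⊩⁺-≤ le a

  -- Validity is taken under double negation: the schema α ∨ (α → β) ∨ ¬β holds in
  -- two-world frames only classically.
  ⊩-axiom : ∀ {φ} → N2Axiom φ → ∀ w → ¬ ¬ (w ⊩⁺ φ)
  ⊩-axiom (K {a}) w k = k λ _ _ x _ le _ → ⊩⁺-≤ le a x
  ⊩-axiom S w k = k λ _ _ f _ le g w₃ le′ x → f w₃ (≤-trans le le′) x w₃ ≤-refl (g w₃ le′ x)
  ⊩-axiom ∧E₁ w k = k λ _ _ → proj₁
  ⊩-axiom ∧E₂ w k = k λ _ _ → proj₂
  ⊩-axiom (∧I {a}) w k = k λ _ _ x _ le y → ⊩⁺-≤ le a x , y
  ⊩-axiom ∨I₁ w k = k λ _ _ → inj₁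
  ⊩-axiom ∨I₂ w k = k λ _ _ → inj₂
  ⊩-axiom ∨E w k = k λ _ _ f _ le g w₃ le′ → λ where
    (inj₁ x) → f w₃ (≤-trans le le′) x
    (inj₂ y) → g w₃ le′ y
  ⊩-axiom ⊥E w k = k λ _ _ ()
  ⊩-axiom N∼⇒ w k = k ((λ _ _ → id) , (λ _ _ → id))
  ⊩-axiom N∼∧ w k = k ((λ _ _ → id) , (λ _ _ → id))
  ⊩-axiom N∼∨ w k = k ((λ _ _ → id) , (λ _ _ → id))
  ⊩-axiom N∼∼ w k = k ((λ _ _ → id) , (λ _ _ → id))
  ⊩-axiom N∼¬ w k = k ((λ _ _ → proj₁) , (λ _ _ x → x , tt))
  ⊩-axiom (N∼at {x}) w k = k λ _ _ n w′ le p → V-consistent w′ x (p , V-≤ le n)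
  ⊩-axiom WEM true k = ¬¬-excluded-middle λ where
    (yes ta) → k (inj₁ ta)
    (no ¬ta) → k (inj₂ (inj₁ λ { true b≤b ta → ⊥-elim (¬ta ta) }))
  ⊩-axiom (WEM {b = b}) false k = ¬¬-excluded-middle λ where
    (yes ha) → k (inj₁ ha)
    (no ¬ha) → ¬¬-excluded-middle λ where
      (yes tb) → k (inj₂ (inj₁ λ { false b≤b ha → ⊥-elim (¬ha ha) ; true f≤t _ → tb }))
      (no ¬tb) → k (inj₂ (inj₂ λ { false b≤b hb → ¬tb (⊩⁺-≤ f≤t b hb) ; true f≤t tb → ¬tb tb }))

  ⊩-sound : ∀ {Γ : Form X → Set} → (∀ ψ → Γ ψ → ∀ w → ¬ ¬ (w ⊩⁺ ψ)) →
            ∀ {φ} → Γ ⊢ φ → ∀ w → ¬ ¬ (w ⊩⁺ φ)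
  ⊩-sound Γ-valid (hyp ψ∈Γ) = Γ-valid _ ψ∈Γ
  ⊩-sound Γ-valid (ax a) = ⊩-axiom a
  ⊩-sound Γ-valid (mp p q) w k =
    ⊩-sound Γ-valid p w λ f → ⊩-sound Γ-valid q w λ x → k (f w ≤-refl x)

-- Countermodel with M "there" and the Occ-literals of M "here".  If the body of a rule holds
-- "there" it is derivable, so by consistency the head lies in M, and it satisfies Occ; thus the
-- whole completion is valid in this model, and so is every literal it derives.
module _ {X : Set} {Π : Program X} {B : List X} {M : Lit X → Set}
         (Occ : Lit X → Set) (Occ-over : ∀ {l} → Occ l → LitOver B l) (Π-occ : All (RuleSat Occ) Π)
         (M-cons : ConsistentLits M) (M-consistent : N2Consistent (Completed (progT Π) B M))
         (M-derives : ∀ l → M l → Completed (progT Π) B M ⊢ litF l) where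
  private
    Γ : Form X → Set
    Γ = Completed (progT Π) B M

    V : Bool → Lit X → Set
    V false l = M l × Occ l
    V true l = M l

    V-intro : ∀ {l} → M l → Occ l → ∀ w → V w l
    V-intro m o false = m , o
    V-intro m o true = m

    V-consistent : ∀ w a → ¬ (V w (pos a) × V w (sneg a))
    V-consistent false a ((p , _) , (q , _)) = M-cons a (p , q)
    V-consistent true a = M-cons a

  open HereThere V proj₁ V-consistent

  private
    pos-derivable : ∀ b → true ⊩⁺ belemF b → Γ ⊢ belemF b
    pos-derivable (blit l) t = M-derives l (⊩-litF⁻ l t)
    pos-derivable btop _ = ⇒-refl
    pos-derivable bbot ()

    neg-derivable : ∀ {b} → All Occ (belemLits b) → true ⊩⁺ neg (belemF b) → Γ ⊢ neg (belemF b)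
    neg-derivable {blit l} (o ∷ []) t =
      hyp (inj₂ (inj₁ (l , Occ-over o , (λ m → t true b≤b (⊩-litF⁺ l m)) , refl)))
    neg-derivable {btop} [] t = ⊥-elim (t true b≤b λ _ _ → id)
    neg-derivable {bbot} [] _ = ⇒-refl

    negs-derivable : ∀ {nb} → BodySat Occ nb → true ⊩⁺ negsF nb → Γ ⊢ negsF nb
    negs-derivable [] _ = ⇒-refl
    negs-derivable (o ∷ os) (t , ts) = ∧-intro (neg-derivable o t) (negs-derivable os ts)

    body-derivable : ∀ pb {nb} → BodySat Occ nb → true ⊩⁺ bodyF pb nb → Γ ⊢ bodyF pb nb
    body-derivable [] nb-occ t = negs-derivable nb-occ t
    body-derivable (b ∷ pb) nb-occ (t , ts) =
      ∧-intro (pos-derivable b t) (body-derivable pb nb-occ ts)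

    head-valid : ∀ {h} → All Occ (headLits h) → Γ ⊢ headF h → ¬ ¬ (∀ w → w ⊩⁺ headF h)
    head-valid {hbot} [] ⊢⊥ _ = M-consistent ⊢⊥
    head-valid {hlit l} (o ∷ []) ⊢l k = ¬¬-excluded-middle λ where
      (yes m) → k λ w → ⊩-litF⁺ l (V-intro m o w)
      (no ¬m) → M-consistent (mp (hyp (inj₂ (inj₁ (l , Occ-over o , ¬m , refl)))) ⊢l)

    rule-valid : ∀ {r} → r ∈ Π → ∀ w → ¬ ¬ (w ⊩⁺ ruleF r)
    rule-valid {rule h pb nb} r∈ w k with All.lookup Π-occ r∈
    ... | h-occ , _ , nb-occ = ¬¬-excluded-middle λ where
      (no ¬body) → k λ w′ _ body → ⊥-elim (¬body (⊩⁺-≤ (≤-maximum w′) (bodyF pb nb) body))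
      (yes body) →
        head-valid h-occ (mp (hyp (inj₁ (∈-map⁺ ruleF r∈))) (body-derivable pb nb-occ body))
          λ head → k λ w′ _ _ → head w′

    completion-valid : ∀ ψ → Γ ψ → ∀ w → ¬ ¬ (w ⊩⁺ ψ)
    completion-valid _ (inj₁ ψ∈) w with r , r∈ , refl ← ∈-map⁻ ruleF ψ∈ = rule-valid r∈ w
    completion-valid _ (inj₂ (inj₁ (l , _ , ¬m , refl))) w k =
      k λ w′ le t → ¬m (V-≤ (≤-maximum w′) (⊩-litF⁻ l t))
    completion-valid _ (inj₂ (inj₂ (l , m , refl))) w k =
      k λ w′ _ ¬t → ¬t true (≤-maximum w′) (⊩-litF⁺ l m)

  answerSet-occurs : ∀ {l} → M l → ¬ ¬ Occ l
  answerSet-occurs {l} m ¬o =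
    ⊩-sound completion-valid (M-derives l m) false (¬o ∘ proj₂ ∘ ⊩-litF⁻ l)

module _ {A B : Set} where
  ∈-zip⁻ : ∀ {a : A} {b : B} {xs ys} → (a , b) ∈ zip xs ys → a ∈ xs × b ∈ ys
  ∈-zip⁻ {xs = _ ∷ _} {_ ∷ _} (here refl) = here refl , here refl
  ∈-zip⁻ {xs = _ ∷ _} {_ ∷ _} (there p) with a∈ , b∈ ← ∈-zip⁻ p = there a∈ , there b∈

  ∈-concatMap⁺′ : ∀ (f : A → List B) {x xs y} → x ∈ xs → y ∈ f x → y ∈ concat (map f xs)
  ∈-concatMap⁺′ f x∈ y∈ = ∈-concat⁺′ y∈ (∈-map⁺ f x∈)

  all-concatMap⁺ : ∀ {P : B → Set} {f : A → List B} {xs} →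
                   (∀ {x} → x ∈ xs → All P (f x)) → All P (concat (map f xs))
  all-concatMap⁺ P-f = concat⁺ (map⁺ (All.tabulate P-f))

module _ {X : Set} where
  LitsOver : List X → Program X → Set
  LitsOver 𝒜 Π = ∀ {l} → l ∈ progLits Π → LitOver 𝒜 l

  ∈-progLits : ∀ {Π : Program X} {r l} → r ∈ Π → l ∈ ruleLits r → l ∈ progLits Π
  ∈-progLits = ∈-concatMap⁺′ ruleLits

  progLits-++ : ∀ (Π Π′ : Program X) → progLits (Π ++ Π′) ≡ progLits Π ++ progLits Π′
  progLits-++ Π Π′ =
    trans (cong concat (map-++ ruleLits Π Π′)) (sym (concat-++ (map ruleLits Π) (map ruleLits Π′)))

  ∈-progLits-++⁻ : ∀ Π {Π′ : Program X} {l} →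
                   l ∈ progLits (Π ++ Π′) → l ∈ progLits Π ⊎ l ∈ progLits Π′
  ∈-progLits-++⁻ Π {Π′} = ∈-++⁻ (progLits Π) ∘ subst (_ ∈_) (progLits-++ Π Π′)

  ∈-progLits-++⁺ˡ : ∀ Π Π′ {l} → l ∈ progLits Π → l ∈ progLits (Π ++ Π′)
  ∈-progLits-++⁺ˡ Π Π′ = subst (_ ∈_) (sym (progLits-++ Π Π′)) ∘ ∈-++⁺ˡ

  ∈-progLits-++⁺ʳ : ∀ Π Π′ {l} → l ∈ progLits Π′ → l ∈ progLits (Π ++ Π′)
  ∈-progLits-++⁺ʳ Π Π′ = subst (_ ∈_) (sym (progLits-++ Π Π′)) ∘ ∈-++⁺ʳ (progLits Π)

  ruleSat-litsOver : ∀ {𝒜 Π r} → LitsOver 𝒜 Π → r ∈ Π → RuleSat (LitOver 𝒜) r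
  ruleSat-litsOver Π-over r∈ = ruleSat-ruleLits _ _ (All.tabulate (Π-over ∘ ∈-progLits r∈))

-- The atoms that can occur in P ⊕₁ Q when P has n rules.  extAtoms also lists rej atoms
-- for the rules of Q, although no rule of P ⊕₁ Q mentions them.
Live : List ℕ → ℕ → XAtom → Set
Live 𝒜 n (orig a) = a ∈ 𝒜
Live 𝒜 n (sub₁ a) = a ∈ 𝒜
Live 𝒜 n (sub₂ a) = a ∈ 𝒜
Live 𝒜 n (rej₁ k) = k ∈ upTo n
Live 𝒜 n (rej₂ k) = ⊥

LiveLit : List ℕ → ℕ → Lit XAtom → Set
LiveLit 𝒜 n l = Live 𝒜 n (atomOf l)

module _ {𝒜 : List ℕ} {n : ℕ} where
  liveLit-mapLit : ∀ {f : ℕ → XAtom} → (∀ {a} → a ∈ 𝒜 → Live 𝒜 n (f a)) →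
                   ∀ l → LitOver 𝒜 l → LiveLit 𝒜 n (mapLit f l)
  liveLit-mapLit f-live (pos a) = f-live
  liveLit-mapLit f-live (sneg a) = f-live

  liveLit-compl : ∀ l → LiveLit 𝒜 n l → LiveLit 𝒜 n (compl l)
  liveLit-compl (pos a) = id
  liveLit-compl (sneg a) = id

module _ (𝒜 : List ℕ) (P Q : Program ℕ) where
  live⇒extAtoms : ∀ {x} → Live 𝒜 (length P) x → x ∈ extAtoms 𝒜 P Q
  live⇒extAtoms {x = orig a} a∈ = ∈-++⁺ˡ (∈-map⁺ orig a∈)
  live⇒extAtoms {x = sub₁ a} a∈ = ∈-++⁺ʳ (map orig 𝒜) (∈-++⁺ˡ (∈-map⁺ sub₁ a∈))
  live⇒extAtoms {x = sub₂ a} a∈ =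
    ∈-++⁺ʳ (map orig 𝒜) (∈-++⁺ʳ (map sub₁ 𝒜) (∈-++⁺ˡ (∈-map⁺ sub₂ a∈)))
  live⇒extAtoms {x = rej₁ k} k∈ =
    ∈-++⁺ʳ (map orig 𝒜) (∈-++⁺ʳ (map sub₁ 𝒜) (∈-++⁺ʳ (map sub₂ 𝒜) (∈-++⁺ˡ (∈-map⁺ rej₁ k∈))))

  extAtoms-live : ∀ {x} → x ∈ extAtoms 𝒜 P Q → Live 𝒜 (length P) x ⊎ ∃ λ k → x ≡ rej₂ k
  extAtoms-live x∈ with ∈-++⁻ (map orig 𝒜) x∈
  ... | inj₁ p with a , a∈ , refl ← ∈-map⁻ orig p = inj₁ a∈
  ... | inj₂ x∈₁ with ∈-++⁻ (map sub₁ 𝒜) x∈₁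
  ...   | inj₁ p with a , a∈ , refl ← ∈-map⁻ sub₁ p = inj₁ a∈
  ...   | inj₂ x∈₂ with ∈-++⁻ (map sub₂ 𝒜) x∈₂
  ...     | inj₁ p with a , a∈ , refl ← ∈-map⁻ sub₂ p = inj₁ a∈
  ...     | inj₂ x∈₃ with ∈-++⁻ (map rej₁ (upTo (length P))) x∈₃
  ...       | inj₁ p with k , k∈ , refl ← ∈-map⁻ rej₁ p = inj₁ k∈
  ...       | inj₂ p with k , _ , refl ← ∈-map⁻ rej₂ p = inj₂ (k , refl)

  live-stable : ∀ {x} → x ∈ extAtoms 𝒜 P Q → ¬ ¬ Live 𝒜 (length P) x → Live 𝒜 (length P) x
  live-stable x∈ ¬¬live with extAtoms-live x∈
  ... | inj₁ live = live
  ... | inj₂ (_ , refl) = ⊥-elim (¬¬live id)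

module _ {𝒜 : List ℕ} (P Q : Program ℕ) (P-over : LitsOver 𝒜 P) (Q-over : LitsOver 𝒜 Q) where
  ⊕₁-live : All (RuleSat (LiveLit 𝒜 (length P))) (P ⊕₁ Q)
  ⊕₁-live =
    ++⁺ (all-concatMap⁺ constraint-live)
        (++⁺ (all-concatMap⁺ part₁-live)
             (++⁺ (all-concatMap⁺ part₂-live) (all-concatMap⁺ part₄-live)))
    where
    Live′ : Lit XAtom → Set
    Live′ = LiveLit 𝒜 (length P)

    PQ-over : LitsOver 𝒜 (P ++ Q)
    PQ-over L∈ with ∈-progLits-++⁻ P L∈
    ... | inj₁ L∈P = P-over L∈P
    ... | inj₂ L∈Q = Q-over L∈Q

    live-orig : ∀ L → LitOver 𝒜 L → Live′ (mapLit orig L)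
    live-orig = liveLit-mapLit id

    live-sub₁ : ∀ L → LitOver 𝒜 L → Live′ (mapLit sub₁ L)
    live-sub₁ = liveLit-mapLit id

    live-sub₂ : ∀ L → LitOver 𝒜 L → Live′ (mapLit sub₂ L)
    live-sub₂ = liveLit-mapLit id

    origs : ∀ {bs} → BodySat (LitOver 𝒜) bs → BodySat Live′ (map (mapBElem orig) bs)
    origs = bodySat-mapBElem (λ {L} → live-orig L)

    constraint-live : ∀ {r} → r ∈ P ++ Q → All (RuleSat Live′) (constraintPart r)
    constraint-live {rule hbot _ _} r∈ =
      let _ , pb-over , nb-over = ruleSat-litsOver PQ-over r∈
      in  ([] , origs pb-over , origs nb-over) ∷ []
    constraint-live {rule (hlit _) _ _} _ = []

    part₁-live : ∀ {x} → x ∈ indexed P → All (RuleSat Live′) (part₁ x)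
    part₁-live {_ , rule hbot _ _} _ = []
    part₁-live {_ , rule (hlit L) _ _} x∈ =
      let k∈ , r∈ = ∈-zip⁻ x∈
          L-over , pb-over , nb-over = ruleSat-litsOver P-over r∈
          compl-L₂-live = liveLit-compl (mapLit sub₂ L) (live-sub₂ L (All.head L-over))
      in  (live-sub₁ L (All.head L-over) ∷ [] , origs pb-over , ++⁺ (origs nb-over) ((k∈ ∷ []) ∷ []))
        ∷ (k∈ ∷ [] , ++⁺ (origs pb-over) ((compl-L₂-live ∷ []) ∷ []) , origs nb-over)
        ∷ []

    part₂-live : ∀ {r} → r ∈ Q → All (RuleSat Live′) (part₂ r)
    part₂-live {rule hbot _ _} _ = []
    part₂-live {rule (hlit L) _ _} r∈ =
      let L-over , pb-over , nb-over = ruleSat-litsOver Q-over r∈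
      in  (live-sub₂ L (All.head L-over) ∷ [] , origs pb-over , origs nb-over) ∷ []

    part₄-live : ∀ {L} → L ∈ progLits (P ++ Q) → All (RuleSat Live′) (part₄ L)
    part₄-live {L} L∈ =
      let L-over = PQ-over L∈
      in  (live-sub₁ L L-over ∷ [] , (live-sub₂ L L-over ∷ []) ∷ [] , [])
      ∷ (live-orig L L-over ∷ [] , (live-sub₁ L L-over ∷ []) ∷ [] , [])
      ∷ []

module ⊕₁-membership (P Q : Program ℕ) where
  ∈-⊕₁-constraint : ∀ {r r′} → r ∈ P ++ Q → r′ ∈ constraintPart r → r′ ∈ P ⊕₁ Q
  ∈-⊕₁-constraint r∈ = ∈-++⁺ˡ ∘ ∈-concatMap⁺′ constraintPart r∈

  ∈-⊕₁-part₁ : ∀ {x r′} → x ∈ indexed P → r′ ∈ part₁ x → r′ ∈ P ⊕₁ Q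
  ∈-⊕₁-part₁ x∈ = ∈-++⁺ʳ (concat (map constraintPart (P ++ Q))) ∘ ∈-++⁺ˡ ∘ ∈-concatMap⁺′ part₁ x∈

  ∈-⊕₁-part₂ : ∀ {r r′} → r ∈ Q → r′ ∈ part₂ r → r′ ∈ P ⊕₁ Q
  ∈-⊕₁-part₂ r∈ =
    ∈-++⁺ʳ (concat (map constraintPart (P ++ Q))) ∘ ∈-++⁺ʳ (concat (map part₁ (indexed P)))
    ∘ ∈-++⁺ˡ ∘ ∈-concatMap⁺′ part₂ r∈

  ∈-⊕₁-part₄ : ∀ {L r′} → L ∈ progLits (P ++ Q) → r′ ∈ part₄ L → r′ ∈ P ⊕₁ Q
  ∈-⊕₁-part₄ L∈ =
    ∈-++⁺ʳ (concat (map constraintPart (P ++ Q))) ∘ ∈-++⁺ʳ (concat (map part₁ (indexed P)))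
    ∘ ∈-++⁺ʳ (concat (map part₂ Q)) ∘ ∈-concatMap⁺′ part₄ L∈

module _ {𝒜 : List ℕ} {P Q Q′ : Program ℕ}
         (Q-tau : TauComp 𝒜 Q) (Q′-over : LitsOver 𝒜 Q′) (Q⊢Q′ : progT Q ⊢* progT Q′) where
  private
    Γ : Form XAtom → Set
    Γ = progT (P ⊕₁ Q)

    ⊕₁-hyp : ∀ {r} → r ∈ P ⊕₁ Q → Γ ⊢ ruleF r
    ⊕₁-hyp = hyp ∘ ∈-map⁺ ruleF

    open ⊕₁-membership P Q

    -- L ← B is recovered from the rules L₂ ← B, L₁ ← L₂ and L ← L₁ of P ⊕₁ Q.
    orig-Q : ∀ {r} → r ∈ Q → Γ ⊢ ruleF (mapRule orig r)
    orig-Q {rule hbot _ _} r∈ = ⊕₁-hyp (∈-⊕₁-constraint (∈-++⁺ʳ P r∈) (here refl))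
    orig-Q {rule (hlit L) _ _} r∈ =
      ⇒-trans (⊕₁-hyp (∈-⊕₁-part₂ r∈ (here refl)))
        (⇒-trans (⇒-∧-verum (⊕₁-hyp (∈-⊕₁-part₄ L∈ (here refl))))
                 (⇒-∧-verum (⊕₁-hyp (∈-⊕₁-part₄ L∈ (there (here refl))))))
      where
      L∈ : L ∈ progLits (P ++ Q)
      L∈ = ∈-progLits-++⁺ʳ P Q (∈-progLits r∈ (here refl))

    orig-Q′ : ∀ {r} → r ∈ Q′ → Γ ⊢ ruleF (mapRule orig r)
    orig-Q′ {r} r∈ =
      subst (Γ ⊢_) (⟦⟧-rename-ruleF orig r) (⊢-rename orig Q-orig (Q⊢Q′ _ (∈-map⁺ ruleF r∈)))
      where
      Q-orig : ∀ φ → progT Q φ → Γ ⊢ φ ⟦ renameLit orig ⟧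
      Q-orig _ φ∈ with r , r∈ , refl ← ∈-map⁻ ruleF φ∈ =
        subst (Γ ⊢_) (sym (⟦⟧-rename-ruleF orig r)) (orig-Q r∈)

    ∈-tau : ∀ {L} → L ∈ progLits Q′ → L ∈ progLits Q
    ∈-tau L∈ = ∈-progLits (Q-tau _ (Q′-over L∈)) (here refl)

    constraint-Q′ : ∀ {r} → r ∈ Q′ → All (λ r′ → Γ ⊢ ruleF r′) (constraintPart r)
    constraint-Q′ {rule hbot _ _} r∈ = orig-Q′ r∈ ∷ []
    constraint-Q′ {rule (hlit _) _ _} _ = []

    -- L₂ ← B follows from L ← B and the rule L₂ ← L coming from the tautology L ← L of Q.
    part₂-Q′ : ∀ {r} → r ∈ Q′ → All (λ r′ → Γ ⊢ ruleF r′) (part₂ r)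
    part₂-Q′ {rule hbot _ _} _ = []
    part₂-Q′ {rule (hlit L) _ _} r∈ =
      ⇒-trans (orig-Q′ r∈) (⇒-∧-verum (⊕₁-hyp (∈-⊕₁-part₂ (Q-tau L (Q′-over L∈)) (here refl)))) ∷ []
      where
      L∈ : L ∈ progLits Q′
      L∈ = ∈-progLits r∈ (here refl)

  ⊕₁-⊢* : progT (P ⊕₁ Q) ⊢* progT (P ⊕₁ Q′)
  ⊕₁-⊢* = ⊢*-progT
    (++⁺ (all-concatMap⁺ constraints)
         (++⁺ (all-concatMap⁺ part₁s)
              (++⁺ (all-concatMap⁺ part₂-Q′) (all-concatMap⁺ part₄s))))
    where
    constraints : ∀ {r} → r ∈ P ++ Q′ → All (λ r′ → Γ ⊢ ruleF r′) (constraintPart r)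
    constraints r∈ with ∈-++⁻ P r∈
    ... | inj₁ r∈P = All.tabulate (⊕₁-hyp ∘ ∈-⊕₁-constraint (∈-++⁺ˡ r∈P))
    ... | inj₂ r∈Q′ = constraint-Q′ r∈Q′

    part₁s : ∀ {x} → x ∈ indexed P → All (λ r′ → Γ ⊢ ruleF r′) (part₁ x)
    part₁s x∈ = All.tabulate (⊕₁-hyp ∘ ∈-⊕₁-part₁ x∈)

    part₄s : ∀ {L} → L ∈ progLits (P ++ Q′) → All (λ r′ → Γ ⊢ ruleF r′) (part₄ L)
    part₄s L∈ with ∈-progLits-++⁻ P L∈
    ... | inj₁ L∈P = All.tabulate (⊕₁-hyp ∘ ∈-⊕₁-part₄ (∈-progLits-++⁺ˡ P Q L∈P))
    ... | inj₂ L∈Q′ = All.tabulate (⊕₁-hyp ∘ ∈-⊕₁-part₄ (∈-progLits-++⁺ʳ P Q (∈-tau L∈Q′)))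

dropRej₂ : Lit XAtom → Form XAtom
dropRej₂ (pos (rej₂ _)) = falsum
dropRej₂ (sneg (rej₂ _)) = falsum
dropRej₂ l = litF l

dropRej₂-N∼at : ∀ {Δ : Form XAtom → Set} x → Δ ⊢ dropRej₂ (sneg x) ⇒ neg (dropRej₂ (pos x))
dropRej₂-N∼at (orig _) = ax N∼at
dropRej₂-N∼at (sub₁ _) = ax N∼at
dropRej₂-N∼at (sub₂ _) = ax N∼at
dropRej₂-N∼at (rej₁ _) = ax N∼at
dropRej₂-N∼at (rej₂ _) = ax ⊥E

module _ {𝒜 : List ℕ} {n : ℕ} where
  dropRej₂-live : ∀ l → LiveLit 𝒜 n l → dropRej₂ l ≡ litF l
  dropRej₂-live (pos (orig _)) _ = refl
  dropRej₂-live (pos (sub₁ _)) _ = refl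
  dropRej₂-live (pos (sub₂ _)) _ = refl
  dropRej₂-live (pos (rej₁ _)) _ = refl
  dropRej₂-live (sneg (orig _)) _ = refl
  dropRej₂-live (sneg (sub₁ _)) _ = refl
  dropRej₂-live (sneg (sub₂ _)) _ = refl
  dropRej₂-live (sneg (rej₁ _)) _ = refl

  ⟦dropRej₂⟧-live : ∀ {l} → LiveLit 𝒜 n l → litF l ⟦ dropRej₂ ⟧ ≡ litF l
  ⟦dropRej₂⟧-live {l} live = trans (⟦⟧-litF dropRej₂ l) (dropRej₂-live l live)

⟦dropRej₂⟧-rej₂ : ∀ l {k} → atomOf l ≡ rej₂ k → litF l ⟦ dropRej₂ ⟧ ≡ falsum
⟦dropRej₂⟧-rej₂ (pos _) refl = refl
⟦dropRej₂⟧-rej₂ (sneg _) refl = refl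

⊕₁-completion : List ℕ → Program ℕ → Program ℕ → (Lit XAtom → Set) → Form XAtom → Set
⊕₁-completion 𝒜 P Q M = Completed (progT (P ⊕₁ Q)) (extAtoms 𝒜 P Q) M

-- Besides the rules, the two completions differ only in hypotheses ¬ rej₂ k about atoms
-- occurring in no rule; replacing those atoms by ⊥ makes these hypotheses trivial.
module _ {𝒜 : List ℕ} (P Q Q′ : Program ℕ) {M : Lit XAtom → Set}
         (Q′⊢Q : progT (P ⊕₁ Q′) ⊢* progT (P ⊕₁ Q))
         (Q-live : All (RuleSat (LiveLit 𝒜 (length P))) (P ⊕₁ Q))
         (M-live : ∀ {l} → M l → LiveLit 𝒜 (length P) l) where
  private
    Γ′ : Form XAtom → Set
    Γ′ = ⊕₁-completion 𝒜 P Q′ M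

    completion-dropRej₂ : ∀ φ → ⊕₁-completion 𝒜 P Q M φ → Γ′ ⊢ φ ⟦ dropRej₂ ⟧
    completion-dropRej₂ _ (inj₁ φ∈) with r , r∈ , refl ← ∈-map⁻ ruleF φ∈ =
      subst (Γ′ ⊢_) (sym (⟦⟧-ruleF-fixed dropRej₂ (dropRej₂-live _) (All.lookup Q-live r∈)))
        (⊢-cut (λ _ → hyp ∘ inj₁) (Q′⊢Q _ φ∈))
    completion-dropRej₂ _ (inj₂ (inj₁ (l , l∈ , ¬m , refl))) with extAtoms-live 𝒜 P Q l∈
    ... | inj₁ live = subst (λ ψ → Γ′ ⊢ neg ψ) (sym (⟦dropRej₂⟧-live live))
                        (hyp (inj₂ (inj₁ (l , live⇒extAtoms 𝒜 P Q′ live , ¬m , refl))))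
    ... | inj₂ (_ , l-rej₂) = subst (λ ψ → Γ′ ⊢ neg ψ) (sym (⟦dropRej₂⟧-rej₂ l l-rej₂)) ⇒-refl
    completion-dropRej₂ _ (inj₂ (inj₂ (l , m , refl))) =
      subst (λ ψ → Γ′ ⊢ neg (neg ψ)) (sym (⟦dropRej₂⟧-live (M-live m)))
        (hyp (inj₂ (inj₂ (l , m , refl))))

  completion-⊢-dropRej₂ : ∀ {φ} → ⊕₁-completion 𝒜 P Q M ⊢ φ →
                          ⊕₁-completion 𝒜 P Q′ M ⊢ φ ⟦ dropRej₂ ⟧
  completion-⊢-dropRej₂ = ⊢-⟦⟧ dropRej₂ dropRej₂-N∼at completion-dropRej₂

updateAnswerSet-transfer : ∀ {𝒜} P Q Q′ {U} → LitsOver 𝒜 P → LitsOver 𝒜 Q → LitsOver 𝒜 Q′ →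
                           TauComp 𝒜 Q → TauComp 𝒜 Q′ → progT Q ≡N2 progT Q′ →
                           UpdateAnswerSet 𝒜 P Q U → UpdateAnswerSet 𝒜 P Q′ U
updateAnswerSet-transfer {𝒜} P Q Q′ P-over Q-over Q′-over Q-tau Q′-tau (Q⊢Q′ , Q′⊢Q)
                         (M , (M-over , M-cons , M-consistent , M-derives) , U≈M) =
  M , (M-over′ , M-cons , M-consistent ∘ transfer-to-Q , M-derives′) , U≈M
  where
  Q-live : All (RuleSat (LiveLit 𝒜 (length P))) (P ⊕₁ Q)
  Q-live = ⊕₁-live P Q P-over Q-over

  Q′-live : All (RuleSat (LiveLit 𝒜 (length P))) (P ⊕₁ Q′)
  Q′-live = ⊕₁-live P Q′ P-over Q′-over

  M-live : ∀ {l} → M l → LiveLit 𝒜 (length P) l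
  M-live {l} m = live-stable 𝒜 P Q (M-over l m)
    (answerSet-occurs _ (live⇒extAtoms 𝒜 P Q) Q-live M-cons M-consistent M-derives m)

  M-over′ : ∀ l → M l → LitOver (extAtoms 𝒜 P Q′) l
  M-over′ _ = live⇒extAtoms 𝒜 P Q′ ∘ M-live

  transfer-to-Q : ∀ {φ} → ⊕₁-completion 𝒜 P Q′ M ⊢ φ → ⊕₁-completion 𝒜 P Q M ⊢ φ ⟦ dropRej₂ ⟧
  transfer-to-Q = completion-⊢-dropRej₂ P Q′ Q (⊕₁-⊢* {P = P} Q-tau Q′-over Q⊢Q′) Q′-live M-live

  transfer-to-Q′ : ∀ {φ} → ⊕₁-completion 𝒜 P Q M ⊢ φ → ⊕₁-completion 𝒜 P Q′ M ⊢ φ ⟦ dropRej₂ ⟧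
  transfer-to-Q′ = completion-⊢-dropRej₂ P Q Q′ (⊕₁-⊢* {P = P} Q′-tau Q-over Q′⊢Q) Q-live M-live

  M-derives′ : ∀ l → M l → ⊕₁-completion 𝒜 P Q′ M ⊢ litF l
  M-derives′ l m = subst (_ ⊢_) (⟦dropRej₂⟧-live (M-live m)) (transfer-to-Q′ (M-derives l m))

corollary4p6 : (P P₁ P₂ : Program ℕ)
    → TauComp (progAtoms (P ++ P₁ ++ P₂)) P₁
    → TauComp (progAtoms (P ++ P₁ ++ P₂)) P₂
    → progT P₁ ≡N2 progT P₂
    → (U : Lit ℕ → Set)
    → (UpdateAnswerSet (progAtoms (P ++ P₁ ++ P₂)) P P₁ U → UpdateAnswerSet (progAtoms (P ++ P₁ ++ P₂)) P P₂ U)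
    × (UpdateAnswerSet (progAtoms (P ++ P₁ ++ P₂)) P P₂ U → UpdateAnswerSet (progAtoms (P ++ P₁ ++ P₂)) P P₁ U)
corollary4p6 P P₁ P₂ P₁-tau P₂-tau P₁≡P₂ U =
    updateAnswerSet-transfer P P₁ P₂ P-over P₁-over P₂-over P₁-tau P₂-tau P₁≡P₂
  , updateAnswerSet-transfer P P₂ P₁ P-over P₂-over P₁-over P₂-tau P₁-tau (swap P₁≡P₂)
  where
  all-over : LitsOver (progAtoms (P ++ P₁ ++ P₂)) (P ++ P₁ ++ P₂)
  all-over = ∈-map⁺ atomOf

  P-over : LitsOver (progAtoms (P ++ P₁ ++ P₂)) P
  P-over = all-over ∘ ∈-progLits-++⁺ˡ P (P₁ ++ P₂)

  P₁-over : LitsOver (progAtoms (P ++ P₁ ++ P₂)) P₁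
  P₁-over = all-over ∘ ∈-progLits-++⁺ʳ P (P₁ ++ P₂) ∘ ∈-progLits-++⁺ˡ P₁ P₂

  P₂-over : LitsOver (progAtoms (P ++ P₁ ++ P₂)) P₂
  P₂-over = all-over ∘ ∈-progLits-++⁺ʳ P (P₁ ++ P₂) ∘ ∈-progLits-++⁺ʳ P₁ P₂
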